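{- For any coloring $(f_0,f_1,f_2)$ of $D_3(m)$, any $t\in\mathbb Z_m$, and any pair of colors $r\ne s$, the plane $P_t=\{v\in V: S(v)=t\}$ is a union of cycles of the Kempe map $\tau_{r,s}=f_s^{ -1}\circ f_r$. In particular, swapping colors $r$ and $s$ on the entire plane $P_t$ is always a valid Kempe swap.
   Context: Let $m\ge 3$, $V=(\mathbb Z_m)^3$, and $e_1,e_2,e_3$ the standard basis vectors; $D_3(m)$ is the digraph on $V$ with arcs $v\to v+e_1,v+e_2,v+e_3$ (mod $m$). A coloring is a triple $(f_0,f_1,f_2)$ of permutations of $V$ with $\{f_0(v),f_1(v),f_2(v)\}=\{v+e_1,v+e_2,v+e_3\}$ for all $v$. The layer function is $S(i,j,k)=i+j+k\pmod m$. A Kempe swap of colors $(r,s)$ on $X$ (exchanging $f_r$ and $f_s$ on $X$) is valid when $X$ is a union of cycles of $\tau_{r,s}$. -}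

module Defs where

open import Data.Nat using (ℕ; zero; suc; _+_; NonZero)
open import Data.Nat.DivMod using (_mod_)
open import Data.Fin using (Fin; toℕ; zero; suc)
open import Data.Product using (_×_; _,_; ∃; ∃-syntax)
open import Function using (_∘_; _↔_; Inverse)
open import Relation.Binary.PropositionalEquality using (_≡_)

-- ℤ_m is represented by Fin m, with arithmetic mod m.
ℤ_ : (m : ℕ) → Set
ℤ m = Fin m

V : ℕ → Set
V m = ℤ m × ℤ m × ℤ m

inc : (m : ℕ) .{{_ : NonZero m}} → ℤ m → ℤ m
inc m x = suc (toℕ x) mod m

-- v + e_i (mod m), colours/directions indexed by Fin 3 (e_1,e_2,e_3 ↦ 0,1,2)
_+e_ : {m : ℕ} .{{_ : NonZero m}} → V m → Fin 3 → V m
_+e_ {m} (i , j , k) zero             = (inc m i , j , k)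
_+e_ {m} (i , j , k) (suc zero)       = (i , inc m j , k)
_+e_ {m} (i , j , k) (suc (suc zero)) = (i , j , inc m k)

S : {m : ℕ} .{{_ : NonZero m}} → V m → ℤ m
S {m} (i , j , k) = (toℕ i + toℕ j + toℕ k) mod m

-- A coloring: three permutations f_0,f_1,f_2 of V with
-- {f_0(v),f_1(v),f_2(v)} = {v+e_1,v+e_2,v+e_3} (as sets) for every v.
record Coloring (m : ℕ) .{{_ : NonZero m}} : Set where
  field
    f        : Fin 3 → (V m ↔ V m)
    out-sub  : ∀ v c → ∃[ d ] Inverse.to (f c) v ≡ v +e d
    out-sup  : ∀ v d → ∃[ c ] Inverse.to (f c) v ≡ v +e d

τ : {m : ℕ} .{{_ : NonZero m}} → Coloring m → Fin 3 → Fin 3 → V m → V m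
τ C r s = Inverse.from (Coloring.f C s) ∘ Inverse.to (Coloring.f C r)

iter : {A : Set} → (A → A) → ℕ → A → A
iter g zero    x = x
iter g (suc n) x = g (iter g n x)

-- X is a union of cycles of the permutation g: with every element,
-- X contains the whole cycle (orbit) of g through it.
UnionOfCycles : {A : Set} → (A → A) → (A → Set) → Set
UnionOfCycles g X = ∀ v n → X v → X (iter g n v)

Plane : {m : ℕ} .{{_ : NonZero m}} → ℤ m → V m → Set
Plane t v = S v ≡ t

-- a Kempe swap of colours (r,s) on X is valid iff X is a union of cycles of τ_{r,s}
ValidKempeSwap : {m : ℕ} .{{_ : NonZero m}} → Coloring m → Fin 3 → Fin 3 → (V m → Set) → Set
ValidKempeSwap C r s X = UnionOfCycles (τ C r s) X

{-# OPTIONS --safe #-}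
-- Every arc v → v + e_d raises the layer S by one. Hence f_r(v) lies in layer S(v) + 1,
-- and so does f_s(τ v) = f_r(v), which lies in layer S(τ v) + 1; as x ↦ x + 1 is injective
-- on ℤ_m, τ_{r,s} preserves S and maps every plane P_t into itself.
module Submission where

open import Defs
open import Data.Nat using (ℕ; NonZero; _≤_; zero; suc; pred; _+_; _%_)
open import Data.Nat.Properties using (+-suc; suc-pred)
open import Data.Nat.DivMod using (_mod_; %-distribˡ-+; m%n%n≡m%n; [m+n]%n≡m%n; m%n<n; m<n⇒m%n≡m)
open import Data.Fin using (Fin; toℕ)
open import Data.Fin.Properties using (toℕ-injective; toℕ-fromℕ<; toℕ<n)
open import Data.Product using (_,_)
open import Function using (Inverse)
open import Relation.Binary.PropositionalEquality

forward-closed⇒UnionOfCycles : {A : Set} {g : A → A} {X : A → Set} →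
                               (∀ x → X x → X (g x)) → UnionOfCycles g X
forward-closed⇒UnionOfCycles closed x zero    Xx = Xx
forward-closed⇒UnionOfCycles closed x (suc n) Xx =
  closed _ (forward-closed⇒UnionOfCycles closed x n Xx)

module _ {m : ℕ} .{{_ : NonZero m}} where

  +-cong-% : ∀ {a a′ b b′} → a % m ≡ a′ % m → b % m ≡ b′ % m → (a + b) % m ≡ (a′ + b′) % m
  +-cong-% {a} {a′} {b} {b′} a≡a′ b≡b′ = begin
    (a + b) % m             ≡⟨ %-distribˡ-+ a b m ⟩
    (a % m + b % m) % m     ≡⟨ cong₂ (λ x y → (x + y) % m) a≡a′ b≡b′ ⟩
    (a′ % m + b′ % m) % m   ≡⟨ %-distribˡ-+ a′ b′ m ⟨
    (a′ + b′) % m           ∎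
    where open ≡-Reasoning

  toℕ-mod : ∀ a → toℕ (a mod m) ≡ a % m
  toℕ-mod a = toℕ-fromℕ< (m%n<n a m)

  toℕ-mod-% : ∀ a → toℕ (a mod m) % m ≡ a % m
  toℕ-mod-% a = trans (cong (_% m) (toℕ-mod a)) (m%n%n≡m%n a m)

  suc-%-injective : ∀ {a b} → suc a % m ≡ suc b % m → a % m ≡ b % m
  suc-%-injective {a} {b} sa≡sb = begin
    a % m                  ≡⟨ [m+n]%n≡m%n a m ⟨
    (a + m) % m            ≡⟨ cong (λ k → (a + k) % m) (suc-pred m) ⟨
    (a + suc (pred m)) % m ≡⟨ cong (_% m) (+-suc a (pred m)) ⟩
    (suc a + pred m) % m   ≡⟨ +-cong-% sa≡sb refl ⟩
    (suc b + pred m) % m   ≡⟨ cong (_% m) (+-suc b (pred m)) ⟨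
    (b + suc (pred m)) % m ≡⟨ cong (λ k → (b + k) % m) (suc-pred m) ⟩
    (b + m) % m            ≡⟨ [m+n]%n≡m%n b m ⟩
    b % m                  ∎
    where open ≡-Reasoning

  inc-injective : ∀ {x y : ℤ m} → inc m x ≡ inc m y → x ≡ y
  inc-injective {x} {y} eq = toℕ-injective (begin
    toℕ x         ≡⟨ m<n⇒m%n≡m (toℕ<n x) ⟨
    toℕ x % m     ≡⟨ suc-%-injective (trans (sym (toℕ-mod _)) (trans (cong toℕ eq) (toℕ-mod _))) ⟩
    toℕ y % m     ≡⟨ m<n⇒m%n≡m (toℕ<n y) ⟩
    toℕ y         ∎)
    where open ≡-Reasoning

  coordSum : V m → ℕ
  coordSum (i , j , k) = toℕ i + toℕ j + toℕ k

  coordSum-+e : ∀ v d → coordSum (v +e d) % m ≡ suc (coordSum v) % m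
  coordSum-+e (i , j , k) Fin.zero =
    +-cong-% (+-cong-% (toℕ-mod-% _) refl) refl
  coordSum-+e (i , j , k) (Fin.suc Fin.zero) =
    trans (+-cong-% (+-cong-% {toℕ i} refl (toℕ-mod-% _)) refl)
          (cong (λ n → (n + toℕ k) % m) (+-suc (toℕ i) (toℕ j)))
  coordSum-+e (i , j , k) (Fin.suc (Fin.suc Fin.zero)) =
    trans (+-cong-% {toℕ i + toℕ j} refl (toℕ-mod-% _))
          (cong (_% m) (+-suc (toℕ i + toℕ j) (toℕ k)))

  S-+e : ∀ v d → S (v +e d) ≡ inc m (S v)
  S-+e v d = toℕ-injective (begin
    toℕ (S (v +e d))          ≡⟨ toℕ-mod _ ⟩
    coordSum (v +e d) % m     ≡⟨ coordSum-+e v d ⟩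
    suc (coordSum v) % m      ≡⟨ +-cong-% {1} refl (toℕ-mod-% _) ⟨
    suc (toℕ (S v)) % m       ≡⟨ toℕ-mod _ ⟨
    toℕ (inc m (S v))         ∎)
    where open ≡-Reasoning

  module _ (C : Coloring m) where
    open Coloring C

    S-colour : ∀ c v → S (Inverse.to (f c) v) ≡ inc m (S v)
    S-colour c v with out-sub v c
    ... | d , fcv≡v+d = trans (cong S fcv≡v+d) (S-+e v d)

    S-τ : ∀ r s v → S (τ C r s v) ≡ S v
    S-τ r s v = inc-injective (begin
      inc m (S (τ C r s v))                ≡⟨ S-colour s (τ C r s v) ⟨
      S (Inverse.to (f s) (τ C r s v))     ≡⟨ cong S (Inverse.strictlyInverseˡ (f s) _) ⟩
      S (Inverse.to (f r) v)               ≡⟨ S-colour r v ⟩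
      inc m (S v)                          ∎)
      where open ≡-Reasoning

corollary2p8 : (m : ℕ) .{{_ : NonZero m}} → 3 ≤ m → (C : Coloring m) → (t : ℤ m) → (r s : Fin 3) → r ≢ s → UnionOfCycles (τ C r s) (Plane t)
corollary2p8 m _ C t r s _ =
  forward-closed⇒UnionOfCycles (λ v Sv≡t → trans (S-τ C r s v) Sv≡t)
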